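{- Let $\mathcal F,\mathcal G\in\beta N$ with $\mathcal F\,\widetilde{\mid}\,\mathcal G$. Then for every $\mathcal H\in\beta N$, $\mathcal F\cdot\mathcal H\,\widetilde{\mid}\,\mathcal G\cdot\mathcal H$ and $\mathcal H\cdot\mathcal F\,\widetilde{\mid}\,\mathcal H\cdot\mathcal G$.
   Context: $\beta N$ is the set of ultrafilters on $N=\{1,2,\dots\}$. For $A\subseteq N$, $n\in N$: $A/n=\{m:mn\in A\}$; $A\in\mathcal F\cdot\mathcal G\iff\{n:A/n\in\mathcal G\}\in\mathcal F$. $A\uparrow=\{n:\exists a\in A\ a\mid n\}$, $\mathcal U=\{A\subseteq N:A\uparrow=A\}$, and $\mathcal F\,\widetilde{\mid}\,\mathcal G\iff\mathcal F\cap\mathcal U\subseteq\mathcal G$. -}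

module Defs where

open import Level using (0ℓ)
open import Data.Nat using (ℕ; suc; _+_; _*_)
open import Data.Nat.Divisibility using (_∣_)
open import Data.Product using (∃; _×_)
open import Data.Sum using (_⊎_)
open import Relation.Nullary using (¬_)
open import Relation.Unary using (Pred; _⊆_; _∩_; ∁; U; ∅)

-- N = {1,2,...} is encoded by ℕ: the code k represents the positive integer k+1.
-- A subset of N is a predicate on codes.
SubN : Set₁
SubN = Pred ℕ 0ℓ

-- Multiplication on N in codes: suc (k ⊙ m) reduces to suc k * suc m.
_⊙_ : ℕ → ℕ → ℕ
k ⊙ m = m + k * suc m

_∣⁺_ : ℕ → ℕ → Set
a ∣⁺ n = suc a ∣ suc n

Fam : Set₁
Fam = Pred SubN 0ℓ

record IsUltrafilter (F : Fam) : Set₁ where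
  field
    full    : F U
    proper  : ¬ F ∅
    upward  : ∀ {A B : SubN} → A ⊆ B → F A → F B
    meet    : ∀ {A B : SubN} → F A → F B → F (A ∩ B)
    ultra   : ∀ (A : SubN) → F A ⊎ F (∁ A)

_/ₙ_ : SubN → ℕ → SubN
(A /ₙ n) m = A (m ⊙ n)

_·_ : Fam → Fam → Fam
(F · G) A = F (λ n → G (A /ₙ n))

_↑ : SubN → SubN
(A ↑) n = ∃ λ a → A a × a ∣⁺ n

InU : SubN → Set
InU A = (A ↑ ⊆ A) × (A ⊆ A ↑)

_∣~_ : Fam → Fam → Set₁
F ∣~ G = ∀ (A : SubN) → InU A → F A → G A

{-# OPTIONS --safe #-}
module Submission where

open import Defs
open import Data.Product using (_×_; _,_)
open import Data.Nat using (suc)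
open import Data.Nat.Divisibility using (∣-refl; *-monoʳ-∣; *-monoˡ-∣)
open import Relation.Unary using (_⊆_)

-- Multiplication on the right by H preserves ∣~ because n ↦ (A/n ∈ H) is again an
-- upward-closed set when A is: A/a ⊆ A/n whenever a ∣ n. Multiplication on the left
-- preserves it because every slice A/n of an upward-closed A is upward closed.

UpwardClosed : Fam → Set₁
UpwardClosed H = ∀ {A B : SubN} → A ⊆ B → H A → H B

⊆-↑ : (A : SubN) → A ⊆ A ↑
⊆-↑ A {n} x = n , x , ∣-refl

↑⊆⇒InU : (A : SubN) → A ↑ ⊆ A → InU A
↑⊆⇒InU A up = up , ⊆-↑ A

⊙-monoʳ-∣⁺ : ∀ {a b} m → a ∣⁺ b → (m ⊙ a) ∣⁺ (m ⊙ b)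
⊙-monoʳ-∣⁺ m = *-monoʳ-∣ (suc m)

⊙-monoˡ-∣⁺ : ∀ {a b} m → a ∣⁺ b → (a ⊙ m) ∣⁺ (b ⊙ m)
⊙-monoˡ-∣⁺ m = *-monoˡ-∣ (suc m)

/ₙ-mono-∣⁺ : (A : SubN) → InU A → ∀ {a n} → a ∣⁺ n → (A /ₙ a) ⊆ (A /ₙ n)
/ₙ-mono-∣⁺ A (up , _) {a} {n} a∣n {m} x = up (m ⊙ a , x , ⊙-monoʳ-∣⁺ m a∣n)

/ₙ-InU : (A : SubN) → InU A → ∀ n → InU (A /ₙ n)
/ₙ-InU A (up , _) n =
  ↑⊆⇒InU (A /ₙ n) λ { (a , x , a∣m) → up (a ⊙ n , x , ⊙-monoˡ-∣⁺ n a∣m) }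

·-slices-InU : (H : Fam) → UpwardClosed H → (A : SubN) → InU A →
               InU (λ n → H (A /ₙ n))
·-slices-InU H upH A AU =
  ↑⊆⇒InU _ λ { (a , HA/a , a∣n) → upH (λ {m} → /ₙ-mono-∣⁺ A AU a∣n {m}) HA/a }

·-monoˡ-∣~ : (F G H : Fam) → UpwardClosed H → F ∣~ G → (F · H) ∣~ (G · H)
·-monoˡ-∣~ F G H upH F∣~G A AU = F∣~G _ (·-slices-InU H upH A AU)

·-monoʳ-∣~ : (F G H : Fam) → UpwardClosed H → F ∣~ G → (H · F) ∣~ (H · G)
·-monoʳ-∣~ F G H upH F∣~G A AU = upH λ {n} → F∣~G (A /ₙ n) (/ₙ-InU A AU n)

lemma3p8 : (F G : Fam) → IsUltrafilter F → IsUltrafilter G → F ∣~ G →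
               (H : Fam) → IsUltrafilter H →
               ((F · H) ∣~ (G · H)) × ((H · F) ∣~ (H · G))
lemma3p8 F G _ _ F∣~G H uH =
  ·-monoˡ-∣~ F G H upward F∣~G , ·-monoʳ-∣~ F G H upward F∣~G
  where open IsUltrafilter uH using (upward)
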